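{- Let $d\geq1$ be an integer, $C>1$ a real, and $\rho$ a growth function with $\rho(x)\geq x$ and $\rho(x)\leq Cx^d$ for all $x\geq1$. Let $m\geq1$ and $0\leq k\leq m$ be integers and $\sigma\in\{ -1,1\}^m$ with $|\sigma|=k$ and $\operatorname{disc}(\sigma)\geq0$. If $(a,b)=f^\rho_\sigma$, then $$0\leq b=2k-m\leq k\quad\text{and}\quad 0\leq a\leq\tau^\rho_{m-k}(k,k)\leq(2C)^{(m-k)d^{m-k}}(2k)^{d^{m-k}}.$$
   Context: A growth function is an increasing $\rho:\mathbb{R}\to\mathbb{R}^{\geq0}$. For $\sigma\in\{ -1,1\}^m$, $|\sigma|$ is the number of entries equal to $1$ and $\operatorname{disc}(\sigma)=\sum_i\sigma_i$. $f^\rho_\sigma\in\mathbb{R}^2$: $f^\rho_{<>}=(0,0)$ for the empty string, and if $f^\rho_\sigma=(a,b)$ then appending $1$ gives $(a+1,b+1)$ and appending $-1$ gives $(a+\rho(a+b),b-1)$. $\tau^\rho_i:\mathbb{Z}^2\to\mathbb{R}$: $\tau^\rho_0(x,y)=x$, $\tau^\rho_{i+1}(x,y)=\tau^\rho_i(x,y)+\rho(\tau^\rho_i(x,y)+y-i)$. -}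

module Defs where

open import Level using (0ℓ)
open import Algebra.Bundles using (CommutativeRing)
open import Relation.Binary.Core using (Rel)
open import Relation.Binary.Structures using (IsTotalOrder)
open import Relation.Nullary using (¬_)
open import Data.Product using (∃; _×_; _,_; proj₁; proj₂)
open import Data.Nat as ℕ using (ℕ; zero; suc)
open import Data.Integer as ℤ using (ℤ; +_; -[1+_])
open import Data.Sign using (Sign)
open import Data.List using (List; []; _∷_; foldl)
open import Data.Vec using (Vec; toList)

-- The real numbers, axiomatised as a (Dedekind-)complete ordered field.
-- Any two such structures are isomorphic, so quantifying over all of
-- them is the same as speaking about ℝ.

record RealField : Set₁ where
  field
    commRing : CommutativeRing 0ℓ 0ℓ
  open CommutativeRing commRing public
    using (Carrier; _≈_; _+_; _*_; -_; 0#; 1#)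
  field
    _≤_          : Rel Carrier 0ℓ
    isTotalOrder : IsTotalOrder _≈_ _≤_
    +-monoˡ-≤    : ∀ {x y} z → x ≤ y → (x + z) ≤ (y + z)
    *-nonneg     : ∀ {x y} → 0# ≤ x → 0# ≤ y → 0# ≤ (x * y)
    0≉1          : ¬ (0# ≈ 1#)
    inverse      : ∀ x → ¬ (x ≈ 0#) → ∃ λ y → (x * y) ≈ 1#
    sup          : (S : Carrier → Set) → ∃ S →
                   (∃ λ u → ∀ x → S x → x ≤ u) →
                   ∃ λ s → (∀ x → S x → x ≤ s) ×
                           (∀ u → (∀ x → S x → x ≤ u) → s ≤ u)

  _<_ : Carrier → Carrier → Set
  x < y = (x ≤ y) × ¬ (x ≈ y)

  _-_ : Carrier → Carrier → Carrier
  x - y = x + (- y)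

  fromℕ : ℕ → Carrier
  fromℕ zero    = 0#
  fromℕ (suc n) = 1# + fromℕ n

  fromℤ : ℤ → Carrier
  fromℤ (+ n)      = fromℕ n
  fromℤ -[1+ n ]   = - fromℕ (suc n)

  _^_ : Carrier → ℕ → Carrier
  x ^ zero  = 1#
  x ^ suc n = x * (x ^ n)

module _ (R : RealField) where
  open RealField R

  record IsGrowth (ρ : Carrier → Carrier) : Set where
    field
      mono    : ∀ {x y} → x ≤ y → ρ x ≤ ρ y
      nonneg  : ∀ x → 0# ≤ ρ x

  -- |σ| : number of entries equal to 1 (encoded as Sign.+)
  count+ : List Sign → ℕ
  count+ []             = zero
  count+ (Sign.+ ∷ s)   = suc (count+ s)
  count+ (Sign.- ∷ s)   = count+ s

  disc : List Sign → ℤ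
  disc []             = + 0
  disc (Sign.+ ∷ s)   = ℤ.1ℤ ℤ.+ disc s
  disc (Sign.- ∷ s)   = ℤ.-1ℤ ℤ.+ disc s

  fstep : (Carrier → Carrier) → Carrier × Carrier → Sign → Carrier × Carrier
  fstep ρ (a , b) Sign.+ = (a + 1# , b + 1#)
  fstep ρ (a , b) Sign.- = (a + ρ (a + b) , b - 1#)

  f : (Carrier → Carrier) → List Sign → Carrier × Carrier
  f ρ σ = foldl (fstep ρ) (0# , 0#) σ

  τ : (Carrier → Carrier) → ℕ → ℤ → ℤ → Carrier
  τ ρ zero    x y = fromℤ x
  τ ρ (suc i) x y = τ ρ i x y + ρ ((τ ρ i x y + fromℤ y) - fromℕ i)

-- Reading σ from left to right, the pair (a, b) = f^ρ keeps track of the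
-- numbers p of entries 1 and q of entries −1 read so far: b = p − q, and
-- a ≤ τ_q(p, p), since an entry 1 raises τ_q(p, p) by at least one and an
-- entry −1 adds ρ(a + b) ≤ ρ(τ_q(p, p) + p − q), which is exactly the step
-- from τ_q to τ_{q+1}.  For the size of τ, put y_i = τ_i(k, k) + k ≥ 1; then
-- y_{i+1} ≤ y_i + ρ(y_i) ≤ 2C y_i^d, and iterating this recurrence from
-- y_0 = 2k gives y_i ≤ (2C)^{i d^i} (2k)^{d^i}.
module Submission where

open import Defs
open import Data.Nat as ℕ using (ℕ)
open import Data.Integer as ℤ using (ℤ; +_)
open import Data.Sign using (Sign)
open import Data.Vec using (Vec; toList)
open import Data.Product using (_×_; proj₁; proj₂)
open import Relation.Binary.PropositionalEquality using (_≡_)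

open import Level using (0ℓ)
open import Data.Nat using (zero; suc; s≤s; z≤n)
import Data.Nat.Properties as ℕₚ
import Data.Integer.Properties as ℤₚ
open import Data.Vec.Properties using (length-toList)
open import Data.List using (List; []; _∷_; foldl; length)
open import Data.Maybe using (nothing)
open import Data.Product using (_,_)
open import Data.Sum using (inj₁; inj₂)
open import Data.Empty using (⊥-elim)
open import Algebra.Bundles using (CommutativeRing)
open import Relation.Binary.Bundles using (Poset)
open import Relation.Binary.Structures using (IsTotalOrder)
import Relation.Binary.Reasoning.PartialOrder as PosetReasoning
open import Relation.Binary.PropositionalEquality
  using (refl; cong; cong₂; module ≡-Reasoning)
  renaming (sym to ≡-sym; trans to ≡-trans)
open import Tactic.RingSolver using (solve-∀)
open import Data.Integer.Tactic.RingSolver using () renaming (solve-∀ to ℤ-solve-∀)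
open import Tactic.RingSolver.Core.AlmostCommutativeRing
  using (AlmostCommutativeRing; fromCommutativeRing)

-- The ring solver only recognises the operations of an AlmostCommutativeRing,
-- which coincide definitionally with those of RealField.  Such a ring need not
-- satisfy x − x ≈ 0, so the solver only proves rearrangements; cancellations
-- are done by hand below.
module RingIdentities (R : RealField) where
  open RealField R using (commRing)

  private
    ring : AlmostCommutativeRing 0ℓ 0ℓ
    ring = fromCommutativeRing commRing (λ _ → nothing)

  open AlmostCommutativeRing ring

  x+y+z≈x+z+y : ∀ x y z → (x + y) + z ≈ (x + z) + y
  x+y+z≈x+z+y = solve-∀ ring

  x+[y-z]≈x+y-z : ∀ x y z → x + (y - z) ≈ (x + y) - z
  x+[y-z]≈x+y-z = solve-∀ ring

  [x-y]+1≈[1+x]-y : ∀ x y → (x - y) + 1# ≈ (1# + x) - y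
  [x-y]+1≈[1+x]-y = solve-∀ ring

  [x-y]-1≈x-[1+y] : ∀ x y → (x - y) - 1# ≈ x - (1# + y)
  [x-y]-1≈x-[1+y] = solve-∀ ring

  [x*y]*[z*w]≈[x*z]*[y*w] : ∀ x y z w → (x * y) * (z * w) ≈ (x * z) * (y * w)
  [x*y]*[z*w]≈[x*z]*[y*w] = solve-∀ ring

module OrderedFieldProperties (R : RealField) where
  open RealField R renaming (_≤_ to infix 4 _≤_; _-_ to infixl 6 _-_; _^_ to infixr 8 _^_)
  open RingIdentities R
  open CommutativeRing commRing
    using ( +-group; ring; +-comm; +-assoc; +-identityˡ; +-identityʳ; -‿inverseʳ; +-cong
          ; *-comm; *-assoc; *-identityˡ; *-identityʳ; *-cong; distribʳ; zeroˡ)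
    renaming (refl to ≈-refl; sym to ≈-sym; trans to ≈-trans; reflexive to ≈-reflexive)
  open IsTotalOrder isTotalOrder using (total; antisym)
  open import Algebra.Properties.Group +-group
    using (//-rightDividesˡ; //-rightDividesʳ; ⁻¹-involutive)
  open import Algebra.Properties.Ring ring using (-1*x≈-x; -‿distribˡ-*)

  poset : Poset 0ℓ 0ℓ 0ℓ
  poset = record { isPartialOrder = IsTotalOrder.isPartialOrder isTotalOrder }

  open Poset poset public
    using (≤-respˡ-≈; ≤-respʳ-≈)
    renaming (refl to ≤-refl; reflexive to ≤-reflexive; trans to ≤-trans)
  open PosetReasoning poset

  +-monoʳ-≤ : ∀ {x y} z → x ≤ y → z + x ≤ z + y
  +-monoʳ-≤ {x} {y} z x≤y = begin
    z + x  ≈⟨ +-comm z x ⟩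
    x + z  ≤⟨ +-monoˡ-≤ z x≤y ⟩
    y + z  ≈⟨ +-comm y z ⟩
    z + y  ∎

  +-mono-≤ : ∀ {x y u v} → x ≤ y → u ≤ v → x + u ≤ y + v
  +-mono-≤ {y = y} {u} x≤y u≤v = ≤-trans (+-monoˡ-≤ u x≤y) (+-monoʳ-≤ y u≤v)

  x≤y⇒0≤y-x : ∀ {x y} → x ≤ y → 0# ≤ y - x
  x≤y⇒0≤y-x {x} {y} x≤y = ≤-respˡ-≈ (-‿inverseʳ x) (+-monoˡ-≤ (- x) x≤y)

  0≤y-x⇒x≤y : ∀ {x y} → 0# ≤ y - x → x ≤ y
  0≤y-x⇒x≤y {x} {y} 0≤y-x = begin
    x            ≈⟨ ≈-sym (+-identityˡ x) ⟩
    0# + x       ≤⟨ +-monoˡ-≤ x 0≤y-x ⟩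
    (y - x) + x  ≈⟨ //-rightDividesˡ x y ⟩
    y            ∎

  -- If 1 ≤ 0 then 0 ≤ −1, and the product of −1 with itself gives 0 ≤ 1.
  0≤1 : 0# ≤ 1#
  0≤1 with total 0# 1#
  ... | inj₁ 0≤1 = 0≤1
  ... | inj₂ 1≤0 = ⊥-elim (0≉1 (antisym 0≤[-1]*[-1] 1≤0))
    where
    0≤-1 : 0# ≤ - 1#
    0≤-1 = ≤-respʳ-≈ (+-identityˡ (- 1#)) (≤-respˡ-≈ (-‿inverseʳ 1#) (+-monoˡ-≤ (- 1#) 1≤0))
    0≤[-1]*[-1] : 0# ≤ 1#
    0≤[-1]*[-1] = ≤-respʳ-≈ (≈-trans (-1*x≈-x (- 1#)) (⁻¹-involutive 1#)) (*-nonneg 0≤-1 0≤-1)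

  +-nonNeg : ∀ {x y} → 0# ≤ x → 0# ≤ y → 0# ≤ x + y
  +-nonNeg 0≤x 0≤y = ≤-respˡ-≈ (+-identityʳ 0#) (+-mono-≤ 0≤x 0≤y)

  x≤x+y : ∀ {x y} → 0# ≤ y → x ≤ x + y
  x≤x+y {x} 0≤y = ≤-respˡ-≈ (+-identityʳ x) (+-monoʳ-≤ x 0≤y)

  x≤y+x : ∀ {x y} → 0# ≤ y → x ≤ y + x
  x≤y+x {x} 0≤y = ≤-respˡ-≈ (+-identityˡ x) (+-monoˡ-≤ x 0≤y)

  x-y≤x : ∀ {x y} → 0# ≤ y → x - y ≤ x
  x-y≤x {x} {y} 0≤y = ≤-respʳ-≈ (//-rightDividesˡ y x) (x≤x+y 0≤y)

  *-monoˡ-≤-nonNeg : ∀ {x y z} → 0# ≤ z → x ≤ y → x * z ≤ y * z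
  *-monoˡ-≤-nonNeg {x} {y} {z} 0≤z x≤y =
    0≤y-x⇒x≤y (≤-respʳ-≈ [y-x]*z≈y*z-x*z (*-nonneg (x≤y⇒0≤y-x x≤y) 0≤z))
    where
    [y-x]*z≈y*z-x*z : (y - x) * z ≈ y * z - x * z
    [y-x]*z≈y*z-x*z = ≈-trans (distribʳ z y (- x)) (+-cong ≈-refl (≈-sym (-‿distribˡ-* x z)))

  *-monoʳ-≤-nonNeg : ∀ {x y z} → 0# ≤ z → x ≤ y → z * x ≤ z * y
  *-monoʳ-≤-nonNeg {x} {y} {z} 0≤z x≤y =
    ≤-respˡ-≈ (*-comm x z) (≤-respʳ-≈ (*-comm y z) (*-monoˡ-≤-nonNeg 0≤z x≤y))

  *-mono-≤-nonNeg : ∀ {x y u v} → 0# ≤ x → 0# ≤ u → x ≤ y → u ≤ v → x * u ≤ y * v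
  *-mono-≤-nonNeg 0≤x 0≤u x≤y u≤v =
    ≤-trans (*-monoˡ-≤-nonNeg 0≤u x≤y) (*-monoʳ-≤-nonNeg (≤-trans 0≤x x≤y) u≤v)

  ^-nonNeg : ∀ {x} → 0# ≤ x → ∀ n → 0# ≤ x ^ n
  ^-nonNeg 0≤x zero    = 0≤1
  ^-nonNeg 0≤x (suc n) = *-nonneg 0≤x (^-nonNeg 0≤x n)

  ^-monoˡ-≤ : ∀ {x y} → 0# ≤ x → x ≤ y → ∀ n → x ^ n ≤ y ^ n
  ^-monoˡ-≤ 0≤x x≤y zero    = ≤-refl
  ^-monoˡ-≤ 0≤x x≤y (suc n) = *-mono-≤-nonNeg 0≤x (^-nonNeg 0≤x n) x≤y (^-monoˡ-≤ 0≤x x≤y n)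

  1≤x⇒1≤x^n : ∀ {x} → 1# ≤ x → ∀ n → 1# ≤ x ^ n
  1≤x⇒1≤x^n 1≤x zero    = ≤-refl
  1≤x⇒1≤x^n 1≤x (suc n) =
    ≤-respˡ-≈ (*-identityˡ 1#) (*-mono-≤-nonNeg 0≤1 0≤1 1≤x (1≤x⇒1≤x^n 1≤x n))

  x≤x^n : ∀ {x} → 1# ≤ x → ∀ n → 1 ℕ.≤ n → x ≤ x ^ n
  x≤x^n {x} 1≤x (suc n) _ =
    ≤-respˡ-≈ (*-identityʳ x) (*-monoʳ-≤-nonNeg (≤-trans 0≤1 1≤x) (1≤x⇒1≤x^n 1≤x n))

  ^-distribˡ-+-* : ∀ x m n → x ^ (m ℕ.+ n) ≈ x ^ m * x ^ n
  ^-distribˡ-+-* x zero    n = ≈-sym (*-identityˡ (x ^ n))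
  ^-distribˡ-+-* x (suc m) n =
    ≈-trans (*-cong ≈-refl (^-distribˡ-+-* x m n)) (≈-sym (*-assoc x (x ^ m) (x ^ n)))

  ^-*-assoc : ∀ x m n → (x ^ m) ^ n ≈ x ^ (m ℕ.* n)
  ^-*-assoc x m zero    = ≈-reflexive (cong (x ^_) (≡-sym (ℕₚ.*-zeroʳ m)))
  ^-*-assoc x m (suc n) = ≈-trans (*-cong ≈-refl (^-*-assoc x m n))
    (≈-trans (≈-sym (^-distribˡ-+-* x m (m ℕ.* n))) (≈-reflexive (cong (x ^_) (≡-sym (ℕₚ.*-suc m n)))))

  ^-distribʳ-* : ∀ x y n → (x * y) ^ n ≈ x ^ n * y ^ n
  ^-distribʳ-* x y zero    = ≈-sym (*-identityˡ 1#)
  ^-distribʳ-* x y (suc n) =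
    ≈-trans (*-cong ≈-refl (^-distribʳ-* x y n)) ([x*y]*[z*w]≈[x*z]*[y*w] x y (x ^ n) (y ^ n))

  fromℕ-+ : ∀ m n → fromℕ (m ℕ.+ n) ≈ fromℕ m + fromℕ n
  fromℕ-+ zero    n = ≈-sym (+-identityˡ (fromℕ n))
  fromℕ-+ (suc m) n = ≈-trans (+-cong ≈-refl (fromℕ-+ m n)) (≈-sym (+-assoc 1# (fromℕ m) (fromℕ n)))

  fromℕ-nonNeg : ∀ n → 0# ≤ fromℕ n
  fromℕ-nonNeg zero    = ≤-refl
  fromℕ-nonNeg (suc n) = +-nonNeg 0≤1 (fromℕ-nonNeg n)

  1≤fromℕ : ∀ {n} → 1 ℕ.≤ n → 1# ≤ fromℕ n
  1≤fromℕ {suc n} _ = x≤x+y (fromℕ-nonNeg n)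

  fromℕ-∸ : ∀ {m n} → n ℕ.≤ m → fromℕ m - fromℕ n ≈ fromℕ (m ℕ.∸ n)
  fromℕ-∸ {m} {n} n≤m = begin-equality
    fromℕ m - fromℕ n                     ≡⟨ cong (λ k → fromℕ k - fromℕ n) (ℕₚ.m∸n+n≡m n≤m) ⟨
    fromℕ (m ℕ.∸ n ℕ.+ n) - fromℕ n       ≈⟨ +-cong (fromℕ-+ (m ℕ.∸ n) n) ≈-refl ⟩
    (fromℕ (m ℕ.∸ n) + fromℕ n) - fromℕ n ≈⟨ //-rightDividesʳ (fromℕ n) (fromℕ (m ℕ.∸ n)) ⟩
    fromℕ (m ℕ.∸ n)                       ∎

  fromℕ-mono-≤ : ∀ {m n} → m ℕ.≤ n → fromℕ m ≤ fromℕ n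
  fromℕ-mono-≤ {m} {n} m≤n = begin
    fromℕ m                       ≤⟨ x≤x+y (fromℕ-nonNeg (n ℕ.∸ m)) ⟩
    fromℕ m + fromℕ (n ℕ.∸ m)     ≈⟨ fromℕ-+ m (n ℕ.∸ m) ⟨
    fromℕ (m ℕ.+ (n ℕ.∸ m))       ≡⟨ cong fromℕ (ℕₚ.m+[n∸m]≡n m≤n) ⟩
    fromℕ n                       ∎

  2*x≈x+x : ∀ x → fromℕ 2 * x ≈ x + x
  2*x≈x+x x = begin-equality
    (1# + (1# + 0#)) * x       ≈⟨ distribʳ x 1# (1# + 0#) ⟩
    1# * x + (1# + 0#) * x     ≈⟨ +-cong (*-identityˡ x) (distribʳ x 1# 0#) ⟩
    x + (1# * x + 0# * x)      ≈⟨ +-cong ≈-refl (+-cong (*-identityˡ x) (zeroˡ x)) ⟩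
    x + (x + 0#)               ≈⟨ +-cong ≈-refl (+-identityʳ x) ⟩
    x + x                      ∎

  iterated-power-bound : ∀ {P d} (y : ℕ → Carrier) → 1 ℕ.≤ d → 1# ≤ P → (∀ i → 0# ≤ y i) →
                         (∀ i → y (suc i) ≤ P * y i ^ d) →
                         ∀ i → y i ≤ P ^ (i ℕ.* d ℕ.^ i) * y 0 ^ (d ℕ.^ i)
  iterated-power-bound y _ _ _ _ zero =
    ≤-reflexive (≈-sym (≈-trans (*-identityˡ (y 0 * 1#)) (*-identityʳ (y 0))))
  iterated-power-bound {P} {d} y 1≤d 1≤P 0≤y step (suc i) = begin
    y (suc i)                                   ≤⟨ step i ⟩
    P * y i ^ d                                 ≤⟨ *-monoʳ-≤-nonNeg 0≤P (^-monoˡ-≤ (0≤y i) ih d) ⟩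
    P * (P ^ a * y 0 ^ e) ^ d                   ≈⟨ *-cong ≈-refl (≈-trans (^-distribʳ-* (P ^ a) (y 0 ^ e) d)
                                                     (*-cong (^-*-assoc P a d) (^-*-assoc (y 0) e d))) ⟩
    P * (P ^ (a ℕ.* d) * y 0 ^ (e ℕ.* d))       ≤⟨ *-monoˡ-≤-nonNeg 0≤rest (x≤x^n 1≤P (d ℕ.^ suc i) 1≤d^[1+i]) ⟩
    P ^ (d ℕ.^ suc i) * (P ^ (a ℕ.* d) * y 0 ^ (e ℕ.* d))
                                                ≈⟨ *-assoc _ _ _ ⟨
    P ^ (d ℕ.^ suc i) * P ^ (a ℕ.* d) * y 0 ^ (e ℕ.* d)
                                                ≈⟨ *-cong (^-distribˡ-+-* P (d ℕ.^ suc i) (a ℕ.* d)) ≈-refl ⟨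
    P ^ (d ℕ.^ suc i ℕ.+ a ℕ.* d) * y 0 ^ (e ℕ.* d)
                                                ≡⟨ cong₂ (λ u v → P ^ u * y 0 ^ v)
                                                     (cong (d ℕ.^ suc i ℕ.+_) a*d≡i*d^[1+i]) (ℕₚ.*-comm e d) ⟩
    P ^ (suc i ℕ.* d ℕ.^ suc i) * y 0 ^ (d ℕ.^ suc i)
                                                ∎
    where
    a = i ℕ.* d ℕ.^ i
    e = d ℕ.^ i
    ih = iterated-power-bound y 1≤d 1≤P 0≤y step i
    0≤P : 0# ≤ P
    0≤P = ≤-trans 0≤1 1≤P
    0≤rest : 0# ≤ P ^ (a ℕ.* d) * y 0 ^ (e ℕ.* d)
    0≤rest = *-nonneg (^-nonNeg 0≤P (a ℕ.* d)) (^-nonNeg (0≤y 0) (e ℕ.* d))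
    1≤d^[1+i] : 1 ℕ.≤ d ℕ.^ suc i
    1≤d^[1+i] = ℕₚ.m^n>0 d {{ℕ.>-nonZero 1≤d}} (suc i)
    a*d≡i*d^[1+i] : a ℕ.* d ≡ i ℕ.* d ℕ.^ suc i
    a*d≡i*d^[1+i] = ≡-trans (ℕₚ.*-assoc i e d) (cong (i ℕ.*_) (ℕₚ.*-comm e d))

count- : List Sign → ℕ
count- []           = zero
count- (Sign.+ ∷ s) = count- s
count- (Sign.- ∷ s) = suc (count- s)

module SignCounting (R : RealField) where

  count+-+-count-≡length : ∀ s → count+ R s ℕ.+ count- s ≡ length s
  count+-+-count-≡length []           = refl
  count+-+-count-≡length (Sign.+ ∷ s) = cong suc (count+-+-count-≡length s)
  count+-+-count-≡length (Sign.- ∷ s) =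
    ≡-trans (ℕₚ.+-suc (count+ R s) (count- s)) (cong suc (count+-+-count-≡length s))

  disc+count-≡count+ : ∀ s → disc R s ℤ.+ + count- s ≡ + count+ R s
  disc+count-≡count+ []           = refl
  disc+count-≡count+ (Sign.+ ∷ s) =
    ≡-trans (ℤₚ.+-assoc ℤ.1ℤ (disc R s) (+ count- s))
            (cong (λ i → ℤ.1ℤ ℤ.+ i) (disc+count-≡count+ s))
  disc+count-≡count+ (Sign.- ∷ s) =
    ≡-trans (-1+i+[1+j]≡i+j (disc R s) (+ count- s)) (disc+count-≡count+ s)
    where
    -1+i+[1+j]≡i+j : ∀ i j → (ℤ.-1ℤ ℤ.+ i) ℤ.+ (ℤ.1ℤ ℤ.+ j) ≡ i ℤ.+ j
    -1+i+[1+j]≡i+j = ℤ-solve-∀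

  count-≤count+ : ∀ s → + 0 ℤ.≤ disc R s → count- s ℕ.≤ count+ R s
  count-≤count+ s 0≤disc = ℤₚ.drop‿+≤+ (ℤₚ.≤-trans
    (ℤₚ.i≤j+i (+ count- s) (disc R s) {{ℤ.nonNegative 0≤disc}})
    (ℤₚ.≤-reflexive (disc+count-≡count+ s)))

  module _ {m} (σ : Vec Sign m) where
    private
      p = count+ R (toList σ)
      q = count- (toList σ)

    count+-+-count-≡m : p ℕ.+ q ≡ m
    count+-+-count-≡m = ≡-trans (count+-+-count-≡length (toList σ)) (length-toList σ)

    m∸count+≡count- : m ℕ.∸ p ≡ q
    m∸count+≡count- = ≡-trans (cong (ℕ._∸ p) (≡-sym count+-+-count-≡m)) (ℕₚ.m+n∸m≡n p q)

    module _ (0≤disc : + 0 ℤ.≤ disc R (toList σ)) where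
      private
        q≤p : q ℕ.≤ p
        q≤p = count-≤count+ (toList σ) 0≤disc

      1≤count+ : 1 ℕ.≤ m → 1 ℕ.≤ p
      1≤count+ 1≤m =
        n≤m⇒1≤m+n⇒1≤m q≤p (ℕₚ.≤-trans 1≤m (ℕₚ.≤-reflexive (≡-sym count+-+-count-≡m)))
        where
        n≤m⇒1≤m+n⇒1≤m : ∀ {m n} → n ℕ.≤ m → 1 ℕ.≤ m ℕ.+ n → 1 ℕ.≤ m
        n≤m⇒1≤m+n⇒1≤m {suc m} _   _  = s≤s z≤n
        n≤m⇒1≤m+n⇒1≤m {zero}  z≤n ()

      2count+-m≡count+∸count- : + (2 ℕ.* p) ℤ.- + m ≡ + (p ℕ.∸ q)
      2count+-m≡count+∸count- = begin
        + (2 ℕ.* p) ℤ.- + m                ≡⟨ cong (λ n → + (2 ℕ.* p) ℤ.- + n) count+-+-count-≡m ⟨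
        + (2 ℕ.* p) ℤ.- + (p ℕ.+ q)        ≡⟨ ℤₚ.m-n≡m⊖n (2 ℕ.* p) (p ℕ.+ q) ⟩
        2 ℕ.* p ℤ.⊖ (p ℕ.+ q)              ≡⟨ ℤₚ.⊖-≥ (ℕₚ.+-monoʳ-≤ p (ℕₚ.≤-trans q≤p (ℕₚ.m≤m+n p 0))) ⟩
        + (p ℕ.+ (p ℕ.+ 0) ℕ.∸ (p ℕ.+ q))  ≡⟨ cong +_ (ℕₚ.[m+n]∸[m+o]≡n∸o p (p ℕ.+ 0) q) ⟩
        + (p ℕ.+ 0 ℕ.∸ q)                  ≡⟨ cong (λ n → + (n ℕ.∸ q)) (ℕₚ.+-identityʳ p) ⟩
        + (p ℕ.∸ q)                        ∎
        where open ≡-Reasoning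

module GrowthFunction
  (R : RealField) {ρ : RealField.Carrier R → RealField.Carrier R} (growth : IsGrowth R ρ) where
  open RealField R renaming (_≤_ to infix 4 _≤_; _-_ to infixl 6 _-_; _^_ to infixr 8 _^_)
  open CommutativeRing commRing
    using (+-comm; *-assoc; *-identityˡ; +-cong; -‿inverseʳ)
    renaming (refl to ≈-refl; sym to ≈-sym; trans to ≈-trans; reflexive to ≈-reflexive)
  open IsGrowth growth
  open OrderedFieldProperties R
  open RingIdentities R
  open PosetReasoning poset

  τ-diag : ℕ → ℕ → Carrier
  τ-diag i k = τ R ρ i (+ k) (+ k)

  fromℕ≤τ-diag : ∀ i k → fromℕ k ≤ τ-diag i k
  fromℕ≤τ-diag zero    k = ≤-refl
  fromℕ≤τ-diag (suc i) k = ≤-trans (fromℕ≤τ-diag i k) (x≤x+y (nonneg _))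

  τ-diag+1≤τ-diag-suc : ∀ i k → τ-diag i k + 1# ≤ τ-diag i (suc k)
  τ-diag+1≤τ-diag-suc zero    k = ≤-reflexive (+-comm (fromℕ k) 1#)
  τ-diag+1≤τ-diag-suc (suc i) k = begin
    τ-diag i k + ρ ((τ-diag i k + fromℕ k) - fromℕ i) + 1#
      ≈⟨ x+y+z≈x+z+y (τ-diag i k) _ 1# ⟩
    τ-diag i k + 1# + ρ ((τ-diag i k + fromℕ k) - fromℕ i)
      ≤⟨ +-mono-≤ ih (mono (+-monoˡ-≤ (- fromℕ i) (+-mono-≤ τ≤τ′ (x≤y+x 0≤1)))) ⟩
    τ-diag i (suc k) + ρ ((τ-diag i (suc k) + fromℕ (suc k)) - fromℕ i)
      ∎
    where
    ih = τ-diag+1≤τ-diag-suc i k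
    τ≤τ′ : τ-diag i k ≤ τ-diag i (suc k)
    τ≤τ′ = ≤-trans (x≤x+y 0≤1) ih

  -- The state of f^ρ after reading p entries 1 and q entries −1.
  record Invariant (p q : ℕ) (ab : Carrier × Carrier) : Set where
    constructor invariant
    field
      a-nonNeg : 0# ≤ proj₁ ab
      b≈p-q    : proj₂ ab ≈ fromℕ p - fromℕ q
      a≤τ-diag : proj₁ ab ≤ τ-diag q p

  plus-step-invariant : ∀ {p q a b} → Invariant p q (a , b) →
                        Invariant (suc p) q (fstep R ρ (a , b) Sign.+)
  plus-step-invariant {p} {q} (invariant 0≤a b≈p-q a≤τ) = invariant
    (+-nonNeg 0≤a 0≤1)
    (≈-trans (+-cong b≈p-q ≈-refl) ([x-y]+1≈[1+x]-y (fromℕ p) (fromℕ q)))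
    (≤-trans (+-monoˡ-≤ 1# a≤τ) (τ-diag+1≤τ-diag-suc q p))

  minus-step-invariant : ∀ {p q a b} → Invariant p q (a , b) →
                         Invariant p (suc q) (fstep R ρ (a , b) Sign.-)
  minus-step-invariant {p} {q} {a} {b} (invariant 0≤a b≈p-q a≤τ) = invariant
    (+-nonNeg 0≤a (nonneg (a + b)))
    (≈-trans (+-cong b≈p-q ≈-refl) ([x-y]-1≈x-[1+y] (fromℕ p) (fromℕ q)))
    (+-mono-≤ a≤τ (mono a+b≤τ+p-q))
    where
    a+b≤τ+p-q : a + b ≤ τ-diag q p + fromℕ p - fromℕ q
    a+b≤τ+p-q = ≤-respʳ-≈ (x+[y-z]≈x+y-z (τ-diag q p) (fromℕ p) (fromℕ q))
                          (+-mono-≤ a≤τ (≤-reflexive b≈p-q))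

  foldl-invariant : ∀ s {p q ab} → Invariant p q ab →
                    Invariant (p ℕ.+ count+ R s) (q ℕ.+ count- s) (foldl (fstep R ρ) ab s)
  foldl-invariant []           {p} {q} inv rewrite ℕₚ.+-identityʳ p | ℕₚ.+-identityʳ q = inv
  foldl-invariant (Sign.+ ∷ s) {p} inv rewrite ℕₚ.+-suc p (count+ R s) =
    foldl-invariant s (plus-step-invariant inv)
  foldl-invariant (Sign.- ∷ s) {q = q} inv rewrite ℕₚ.+-suc q (count- s) =
    foldl-invariant s (minus-step-invariant inv)

  f-invariant : ∀ s → Invariant (count+ R s) (count- s) (f R ρ s)
  f-invariant s = foldl-invariant s (invariant ≤-refl (≈-sym (-‿inverseʳ 0#)) ≤-refl)

  module _ {d : ℕ} {C : Carrier} (1≤d : 1 ℕ.≤ d) (1≤C : 1# ≤ C)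
           (ρ≤Cx^d : ∀ x → 1# ≤ x → ρ x ≤ C * x ^ d) {k : ℕ} (1≤k : 1 ℕ.≤ k) where

    -- The shift by k bounds the argument τ_i + k − i of ρ by y_i.
    y : ℕ → Carrier
    y i = τ-diag i k + fromℕ k

    1≤y : ∀ i → 1# ≤ y i
    1≤y i = ≤-trans (1≤fromℕ 1≤k) (x≤y+x (≤-trans (fromℕ-nonNeg k) (fromℕ≤τ-diag i k)))

    y-step : ∀ i → y (suc i) ≤ fromℕ 2 * C * y i ^ d
    y-step i = begin
      τ-diag i k + ρ (y i - fromℕ i) + fromℕ k  ≈⟨ x+y+z≈x+z+y (τ-diag i k) _ (fromℕ k) ⟩
      y i + ρ (y i - fromℕ i)                   ≤⟨ +-mono-≤ y≤Cy^d ρ[y-i]≤Cy^d ⟩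
      C * y i ^ d + C * y i ^ d                 ≈⟨ 2*x≈x+x (C * y i ^ d) ⟨
      fromℕ 2 * (C * y i ^ d)                   ≈⟨ *-assoc (fromℕ 2) C (y i ^ d) ⟨
      fromℕ 2 * C * y i ^ d                     ∎
      where
      y≤Cy^d : y i ≤ C * y i ^ d
      y≤Cy^d = ≤-trans (x≤x^n (1≤y i) d 1≤d)
                 (≤-respˡ-≈ (*-identityˡ _) (*-monoˡ-≤-nonNeg (^-nonNeg (≤-trans 0≤1 (1≤y i)) d) 1≤C))
      ρ[y-i]≤Cy^d : ρ (y i - fromℕ i) ≤ C * y i ^ d
      ρ[y-i]≤Cy^d = ≤-trans (mono (x-y≤x (fromℕ-nonNeg i))) (ρ≤Cx^d (y i) (1≤y i))

    τ-diag-bound : ∀ i → τ-diag i k ≤ (fromℕ 2 * C) ^ (i ℕ.* d ℕ.^ i) * fromℕ (2 ℕ.* k) ^ (d ℕ.^ i)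
    τ-diag-bound i = begin
      τ-diag i k                       ≤⟨ x≤x+y (fromℕ-nonNeg k) ⟩
      y i                              ≤⟨ iterated-power-bound y 1≤d 1≤2C (λ j → ≤-trans 0≤1 (1≤y j)) y-step i ⟩
      P ^ (i ℕ.* d ℕ.^ i) * y 0 ^ (d ℕ.^ i)
                                       ≤⟨ *-monoʳ-≤-nonNeg (^-nonNeg (≤-trans 0≤1 1≤2C) (i ℕ.* d ℕ.^ i))
                                            (^-monoˡ-≤ (≤-trans 0≤1 (1≤y 0)) (≤-reflexive y₀≈2k) (d ℕ.^ i)) ⟩
      P ^ (i ℕ.* d ℕ.^ i) * fromℕ (2 ℕ.* k) ^ (d ℕ.^ i)
                                       ∎
      where
      P = fromℕ 2 * C
      1≤2C : 1# ≤ P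
      1≤2C = ≤-trans 1≤C (≤-respʳ-≈ (≈-sym (2*x≈x+x C)) (x≤x+y (≤-trans 0≤1 1≤C)))
      y₀≈2k : y 0 ≈ fromℕ (2 ℕ.* k)
      y₀≈2k = ≈-sym (≈-trans (fromℕ-+ k (k ℕ.+ 0))
                             (+-cong ≈-refl (≈-reflexive (cong fromℕ (ℕₚ.+-identityʳ k)))))

lemma4p17 : (R : RealField) → let open RealField R in
    (d : ℕ) → 1 ℕ.≤ d → (C : Carrier) → 1# < C →
    (ρ : Carrier → Carrier) → IsGrowth R ρ →
    (∀ x → 1# ≤ x → x ≤ ρ x) →
    (∀ x → 1# ≤ x → ρ x ≤ (C * (x ^ d))) →
    (m k : ℕ) → 1 ℕ.≤ m → k ℕ.≤ m →
    (σ : Vec Sign m) → count+ R (toList σ) ≡ k → + 0 ℤ.≤ disc R (toList σ) →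
    let a = proj₁ (f R ρ (toList σ))
        b = proj₂ (f R ρ (toList σ))
    in ((0# ≤ b) × (b ≈ fromℤ ((+ (2 ℕ.* k)) ℤ.- (+ m))) × (b ≤ fromℕ k))
     × ((0# ≤ a) × (a ≤ τ R ρ (m ℕ.∸ k) (+ k) (+ k))
        × (τ R ρ (m ℕ.∸ k) (+ k) (+ k)
             ≤ (((fromℕ 2 * C) ^ ((m ℕ.∸ k) ℕ.* (d ℕ.^ (m ℕ.∸ k))))
                 * ((fromℕ (2 ℕ.* k)) ^ (d ℕ.^ (m ℕ.∸ k))))))
lemma4p17 R d 1≤d C (1≤C , _) ρ growth _ ρ≤Cx^d m .(count+ R (toList σ)) 1≤m _ σ refl 0≤disc
  rewrite SignCounting.m∸count+≡count- R σ =
    (0≤b , b≈2k-m , b≤k) ,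
    (a-nonNeg , a≤τ-diag , τ-diag-bound 1≤d 1≤C ρ≤Cx^d (1≤count+ σ 0≤disc 1≤m) q)
  where
  open RealField R using (_≈_; _≤_; 0#; fromℕ; fromℤ)
  open CommutativeRing (RealField.commRing R)
    using () renaming (sym to ≈-sym; trans to ≈-trans; reflexive to ≈-reflexive)
  open OrderedFieldProperties R
  open GrowthFunction R growth
  open SignCounting R
  s = toList σ
  p = count+ R s
  q = count- s
  b = proj₂ (f R ρ s)
  open Invariant (f-invariant s)
  b≈p∸q : b ≈ fromℕ (p ℕ.∸ q)
  b≈p∸q = ≈-trans b≈p-q (fromℕ-∸ (count-≤count+ s 0≤disc))
  0≤b : 0# ≤ b
  0≤b = ≤-respʳ-≈ (≈-sym b≈p∸q) (fromℕ-nonNeg (p ℕ.∸ q))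
  b≈2k-m : b ≈ fromℤ (+ (2 ℕ.* p) ℤ.- + m)
  b≈2k-m = ≈-trans b≈p∸q (≈-reflexive (cong fromℤ (≡-sym (2count+-m≡count+∸count- σ 0≤disc))))
  b≤k : b ≤ fromℕ p
  b≤k = ≤-respˡ-≈ (≈-sym b≈p∸q) (fromℕ-mono-≤ (ℕₚ.m∸n≤m p q))
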